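{- (Directed Star-Comb Lemma) Let $D$ be any strongly connected digraph and let $U\subseteq V(D)$ be infinite. Then $D$ contains a star or comb attached to $U$ and a reverse star or reverse comb attached to $U$, such that the two have the same attachment set.
   Context: Digraphs have no loops and no parallel edges, but may contain both $uv$ and $vu$. A (directed) ray is a digraph on distinct vertices $v_0,v_1,\dots$ with edges $v_iv_{i+1}$. A comb is the union of a ray $R$ (its spine) with infinitely many pairwise disjoint finite directed paths (possibly trivial) each having exactly its first vertex on $R$; the last vertices of these paths are the teeth. A star here is a subdivided infinite directed star: an arborescence (rooted oriented tree containing a directed path from the root to every vertex) whose underlying undirected tree is a subdivision of an infinite star with centre the root; its leaves are the leaves of that tree. The reverse of a digraph is obtained by reversing every edge; a reverse comb (reverse star) is the reverse of a comb (star), with the same teeth (leaves). A (reverse) comb is attached to $U$ if all its teeth lie in $U$, and its attachment set is its set of teeth; a (reverse) star is attached to $U$ if all its leaves lie in $U$, and its attachment set is its set of leaves. -}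

module Defs where

open import Level using (0ℓ)
open import Data.Nat using (ℕ; zero; suc)
open import Data.Fin using (Fin; zero; suc; inject₁; fromℕ)
open import Data.List using (List)
open import Data.List.Membership.Propositional using (_∈_)
open import Data.Product using (Σ; ∃; ∃-syntax; _×_; _,_)
open import Data.Sum using (_⊎_)
open import Data.Empty using (⊥)
open import Relation.Nullary using (¬_)
open import Relation.Binary.PropositionalEquality using (_≡_; _≢_)
open import Relation.Binary.Construct.Closure.ReflexiveTransitive using (Star)
open import Function.Bundles using (_⇔_)

-- A digraph: a vertex type and an edge relation without loops.
-- (Parallel edges play no role: all substructures are described by
-- vertex sequences whose consecutive vertices are joined by an edge.)
record Digraph : Set₁ where
  field
    V      : Set
    E      : V → V → Set
    noLoop : ∀ v → ¬ E v v
open Digraph public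

reverse : Digraph → Digraph
reverse D = record { V = V D ; E = λ u v → E D v u ; noLoop = noLoop D }

StronglyConnected : Digraph → Set
StronglyConnected D = ∀ (u v : V D) → Star (E D) u v

FiniteSubset : {A : Set} → (A → Set) → Set
FiniteSubset {A} U = ∃[ xs ] (∀ (a : A) → U a → a ∈ xs)

InfiniteSubset : {A : Set} → (A → Set) → Set
InfiniteSubset U = ¬ FiniteSubset U

InfiniteType : Set → Set
InfiniteType I = ¬ (∃[ xs ] (∀ (i : I) → i ∈ xs))

Injective : {A B : Set} → (A → B) → Set
Injective f = ∀ {x y} → f x ≡ f y → x ≡ y

-- Legs: infinitely many
-- (index type I infinite) pairwise disjoint finite directed paths
-- (leg k has vertices leg k 0, ..., leg k (len k)), each meeting the
-- spine exactly in its first vertex.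
record Comb (D : Digraph) (L : V D → Set) : Set₁ where
  field
    spine      : ℕ → V D
    spine-inj  : Injective spine
    spine-edge : ∀ n → E D (spine n) (spine (suc n))
    I          : Set
    I-inf      : InfiniteType I
    len        : I → ℕ
    leg        : (k : I) → Fin (suc (len k)) → V D
    leg-inj    : ∀ k → Injective (leg k)
    leg-edge   : ∀ k (j : Fin (len k)) → E D (leg k (inject₁ j)) (leg k (suc j))
    leg-first  : ∀ k → ∃[ n ] (leg k zero ≡ spine n)
    leg-rest   : ∀ k (j : Fin (len k)) (n : ℕ) → leg k (suc j) ≢ spine n
    leg-disj   : ∀ k k' (j : Fin (suc (len k))) (j' : Fin (suc (len k'))) →
                 k ≢ k' → leg k j ≢ leg k' j'
    teeth      : ∀ v → L v ⇔ (∃[ k ] (leg k (fromℕ (len k)) ≡ v))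

-- A (subdivided infinite directed) star in D whose set of leaves is
-- exactly L: a centre and infinitely many (index type I infinite)
-- non-trivial directed paths starting at the centre, pairwise meeting only
-- in the centre.  Leaves = last vertices.  (Their union is an arborescence
-- rooted at the centre whose underlying tree subdivides an infinite star.)
record Star* (D : Digraph) (L : V D → Set) : Set₁ where
  field
    centre     : V D
    I          : Set
    I-inf      : InfiniteType I
    len        : I → ℕ    -- leg k has len k + 1 ≥ 1 edges
    leg        : (k : I) → Fin (suc (suc (len k))) → V D
    leg-inj    : ∀ k → Injective (leg k)
    leg-edge   : ∀ k (j : Fin (suc (len k))) → E D (leg k (inject₁ j)) (leg k (suc j))
    leg-root   : ∀ k → leg k zero ≡ centre
    leg-disj   : ∀ k k' (j : Fin (suc (suc (len k)))) (j' : Fin (suc (suc (len k')))) →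
                 k ≢ k' → leg k j ≡ leg k' j' → (j ≡ zero) × (j' ≡ zero)
    leaves     : ∀ v → L v ⇔ (∃[ k ] (leg k (fromℕ (suc (len k))) ≡ v))

ReverseComb : (D : Digraph) → (V D → Set) → Set₁
ReverseComb D L = Comb (reverse D) L

ReverseStar : (D : Digraph) → (V D → Set) → Set₁
ReverseStar D L = Star* (reverse D) L

_⊆_ : {A : Set} → (A → Set) → (A → Set) → Set
P ⊆ Q = ∀ a → P a → Q a

-- Fix infinitely many distinct targets t i in U and a shortest-path out-tree from a root, and
-- call a vertex rich if infinitely many targets lie in its subtree.  If some rich vertex has no
-- rich child, the tree paths from it into the subtrees of infinitely many distinct children form
-- a star.  Otherwise the rich vertices contain a ray from the root, and the tree paths to
-- targets leaving the ray at ever later points form a comb.  Either way every subsequence of the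
-- selected targets still spans a star or comb, so rerunning the argument in the reverse digraph
-- on the selected targets yields a common attachment set.
module Submission where

open import Defs
open import Level using (0ℓ)
open import Axiom.ExcludedMiddle using (ExcludedMiddle)
open import Data.Nat using (ℕ; zero; suc; pred; _+_; _∸_; _≤_; _<_; _≤′_; ≤′-reflexive; ≤′-step; z≤n; s≤s; _≟_)
open import Data.Nat.Properties
open import Data.Nat.Induction using (<-rec)
open import Data.Nat.GeneralisedArithmetic using (fold; fold-+)
open import Data.Nat.InfinitelyOften using () renaming (Fin to FinitelyOften; Inf to InfinitelyOften)
open import Data.Fin using (Fin; zero; suc; inject₁; fromℕ; toℕ)
open import Data.Fin.Properties using (toℕ-injective; toℕ-inject₁; toℕ-fromℕ; toℕ<n)
open import Data.Vec.Functional as Vector using ()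
open import Data.List using (List; []; _∷_)
open import Data.Nat.ListAction using (sum)
open import Data.List.Relation.Unary.Any using (here; there)
open import Data.List.Membership.Propositional using (_∈_)
open import Data.Product using (∃-syntax; _×_; _,_; proj₁; proj₂)
open import Data.Sum using (_⊎_; inj₁; inj₂)
open import Function using (_∘_; id)
open import Function.Bundles using (mk⇔)
open import Relation.Nullary using (¬_; yes; no; contradiction)
open import Relation.Binary.Definitions using (tri<; tri≈; tri>)
open import Relation.Binary.PropositionalEquality
open import Relation.Binary.Construct.Closure.ReflexiveTransitive as Star using (Star; ε; _◅_)

wlog-< : {R : ℕ → ℕ → Set} → (∀ {a b} → R a b → R b a) →
         (∀ {a b} → a < b → R a b) → ∀ {a b} → a ≢ b → R a b
wlog-< R-sym R-< {a} {b} a≢b with <-cmp a b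
... | tri< a<b _ _ = R-< a<b
... | tri≈ _ a≡b _ = contradiction a≡b a≢b
... | tri> _ _ b<a = R-sym (R-< b<a)

injective-if-< : {A : Set} {f : ℕ → A} → (∀ {a b} → a < b → f a ≢ f b) → Injective f
injective-if-< {f = f} separated {a} {b} fa≡fb with a ≟ b
... | yes a≡b = a≡b
... | no a≢b = contradiction fa≡fb (wlog-< {R = λ a b → f a ≢ f b} (_∘ sym) separated a≢b)

module _ {A : Set} {R : A → A → Set} (R-refl : ∀ {a} → R a a)
         (R-trans : ∀ {a b c} → R a b → R b c → R a c)
         (f : ℕ → A) (step : ∀ n → R (f n) (f (suc n))) where

  stepwise′ : ∀ {m n} → m ≤′ n → R (f m) (f n)
  stepwise′ (≤′-reflexive refl) = R-refl
  stepwise′ (≤′-step m≤′n) = R-trans (stepwise′ m≤′n) (step _)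

  stepwise : ∀ {m n} → m ≤ n → R (f m) (f n)
  stepwise = stepwise′ ∘ ≤⇒≤′

module _ {f : ℕ → ℕ} (increasing : ∀ n → f n < f (suc n)) where

  increasing⇒monotone : ∀ {m n} → m ≤ n → f m ≤ f n
  increasing⇒monotone = stepwise {R = _≤_} ≤-refl ≤-trans f (λ n → <⇒≤ (increasing n))

  increasing⇒strictly-monotone : ∀ {m n} → m < n → f m < f n
  increasing⇒strictly-monotone m<n = <-≤-trans (increasing _) (increasing⇒monotone m<n)

∈⇒≤sum : ∀ {n ns} → n ∈ ns → n ≤ sum ns
∈⇒≤sum {ns = n ∷ ns} (here refl) = m≤m+n n (sum ns)
∈⇒≤sum {ns = m ∷ ns} (there n∈ns) = m≤n⇒m≤o+n m (∈⇒≤sum n∈ns)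

∷-injective : ∀ {A : Set} {n} {a : A} {f : Fin n → A} →
              (∀ j → f j ≢ a) → Injective f → Injective (a Vector.∷ f)
∷-injective f≢a f-inj {zero} {zero} _ = refl
∷-injective f≢a f-inj {zero} {suc j} a≡fj = contradiction (sym a≡fj) (f≢a j)
∷-injective f≢a f-inj {suc i} {zero} fi≡a = contradiction fi≡a (f≢a i)
∷-injective f≢a f-inj {suc i} {suc j} fi≡fj = cong suc (f-inj fi≡fj)

ℕ-infinite : InfiniteType ℕ
ℕ-infinite (ns , complete) = 1+n≰n (∈⇒≤sum (complete (suc (sum ns))))

Image : {A : Set} → (ℕ → A) → A → Set
Image f a = ∃[ k ] f k ≡ a

StarOrComb : (D : Digraph) → (V D → Set) → Set₁
StarOrComb D L = Star* D L ⊎ Comb D L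

module Classical (lem : ExcludedMiddle 0ℓ) where

  ¬¬-elim : {P : Set} → ¬ ¬ P → P
  ¬¬-elim {P} ¬¬p with lem {P}
  ... | yes p = p
  ... | no ¬p = contradiction ¬p ¬¬p

  least-witness : (P : ℕ → Set) → ∀ n → P n → ∃[ m ] P m × (∀ k → k < m → ¬ P k)
  least-witness P = <-rec (λ n → P n → ∃[ m ] P m × (∀ k → k < m → ¬ P k)) step
    where
    step : ∀ n → (∀ {m} → m < n → P m → ∃[ l ] P l × (∀ k → k < l → ¬ P k)) →
           P n → ∃[ m ] P m × (∀ k → k < m → ¬ P k)
    step n smaller pn with lem {∃[ m ] m < n × P m}
    ... | yes (m , m<n , pm) = smaller m<n pm
    ... | no none = n , pn , λ k k<n pk → none (k , k<n , pk)

  unbounded : {P : ℕ → Set} → InfinitelyOften P → ∀ N → ∃[ i ] N ≤ i × P i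
  unbounded inf N = ¬¬-elim λ none → inf (N , λ i N≤i pi → none (i , N≤i , pi))

  fresh : {A : Set} {U : A → Set} → InfiniteSubset U → (xs : List A) → ∃[ a ] U a × ¬ a ∈ xs
  fresh infinite xs = ¬¬-elim λ none →
    infinite (xs , λ a ua → ¬¬-elim λ a∉xs → none (a , ua , a∉xs))

  injective-enumeration : {A : Set} {U : A → Set} → InfiniteSubset U →
                          ∃[ t ] Injective t × (∀ n → U (t n))
  injective-enumeration {A} {U} infinite = t , injective-if-< t-separated , proj₁ ∘ proj₂ ∘ next
    where
    earlier : ℕ → List A
    next : ∀ n → ∃[ a ] U a × ¬ a ∈ earlier n
    earlier zero = []
    earlier (suc n) = proj₁ (next n) ∷ earlier n
    next n = fresh infinite (earlier n)

    t : ℕ → A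
    t = proj₁ ∘ next

    t∈earlier : ∀ {m n} → m < n → t m ∈ earlier n
    t∈earlier {m} {suc n} (s≤s m≤n) with m≤n⇒m<n∨m≡n m≤n
    ... | inj₁ m<n = there (t∈earlier m<n)
    ... | inj₂ refl = here refl

    t-separated : ∀ {m n} → m < n → t m ≢ t n
    t-separated {m} {n} m<n tm≡tn = proj₂ (proj₂ (next n)) (subst (_∈ earlier n) tm≡tn (t∈earlier m<n))

module ShortestPathTree (lem : ExcludedMiddle 0ℓ) (D : Digraph) (root : V D)
                        (reach : ∀ v → Star (E D) root v) where
  open Classical lem

  Walk : V D → ℕ → V D → Set
  Walk a zero b = a ≡ b
  Walk a (suc n) b = ∃[ u ] Walk a n u × E D u b

  edge◅walk : ∀ n {a b c} → E D a b → Walk b n c → Walk a (suc n) c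
  edge◅walk zero {a} ab refl = a , refl , ab
  edge◅walk (suc n) ab (u , w , uc) = u , edge◅walk n ab w , uc

  star⇒walk : ∀ {a b} → Star (E D) a b → ∃[ n ] Walk a n b
  star⇒walk ε = 0 , refl
  star⇒walk (ab ◅ s) = let (n , w) = star⇒walk s in suc n , edge◅walk n ab w

  -- Abstract: unfolding depth into the classical search makes type checking blow up.
  abstract
    shortest : ∀ v → ∃[ n ] Walk root n v × (∀ k → k < n → ¬ Walk root k v)
    shortest v = let (n , w) = star⇒walk (reach v) in least-witness (λ n → Walk root n v) n w

  depth : V D → ℕ
  depth v = proj₁ (shortest v)

  shortest-walk : ∀ v → Walk root (depth v) v
  shortest-walk v = proj₁ (proj₂ (shortest v))

  depth-minimal : ∀ {v n} → Walk root n v → depth v ≤ n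
  depth-minimal {v} {n} w = ≮⇒≥ λ n<depth → proj₂ (proj₂ (shortest v)) n n<depth w

  penultimate : ∀ n {v} → Walk root n v → V D
  penultimate zero _ = root
  penultimate (suc n) (u , _ , _) = u

  -- The root is its own parent.
  parent : V D → V D
  parent v = penultimate (depth v) (shortest-walk v)

  depth-root : depth root ≡ 0
  depth-root = n≤0⇒n≡0 (depth-minimal {n = 0} refl)

  depth≡0⇒root : ∀ {v} → depth v ≡ 0 → v ≡ root
  depth≡0⇒root {v} depth≡0 with depth v | shortest-walk v
  ... | zero | root≡v = sym root≡v

  depth-parent : ∀ v → depth (parent v) ≡ pred (depth v)
  depth-parent v = penultimate-depth (depth v) (shortest-walk v) (proj₂ (proj₂ (shortest v)))
    where
    penultimate-depth : ∀ n (w : Walk root n v) → (∀ k → k < n → ¬ Walk root k v) →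
                        depth (penultimate n w) ≡ pred n
    penultimate-depth zero _ _ = depth-root
    penultimate-depth (suc n) (u , w , uv) shorter-impossible =
      ≤-antisym (depth-minimal w)
        (≮⇒≥ λ du<n → shorter-impossible (suc (depth u)) (s≤s du<n) (u , shortest-walk u , uv))

  parent-edge : ∀ {v} → depth v ≢ 0 → E D (parent v) v
  parent-edge {v} = penultimate-edge (depth v) (shortest-walk v)
    where
    penultimate-edge : ∀ n (w : Walk root n v) → n ≢ 0 → E D (penultimate n w) v
    penultimate-edge zero _ 0≢0 = contradiction refl 0≢0
    penultimate-edge (suc n) (_ , _ , uv) _ = uv

  -- The vertex at depth m on the tree path from the root to v (meaningful for m ≤ depth v).
  ancestor : V D → ℕ → V D
  ancestor v m = fold v parent (depth v ∸ m)

  depth-fold-parent : ∀ k v → depth (fold v parent k) ≡ depth v ∸ k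
  depth-fold-parent zero v = refl
  depth-fold-parent (suc k) v = begin
    depth (parent (fold v parent k)) ≡⟨ depth-parent _ ⟩
    pred (depth (fold v parent k))   ≡⟨ cong pred (depth-fold-parent k v) ⟩
    pred (depth v ∸ k)               ≡⟨ pred[m∸n]≡m∸[1+n] (depth v) k ⟩
    depth v ∸ suc k                  ∎
    where open ≡-Reasoning

  depth-ancestor : ∀ {v m} → m ≤ depth v → depth (ancestor v m) ≡ m
  depth-ancestor {v} {m} m≤depth = trans (depth-fold-parent (depth v ∸ m) v) (m∸[m∸n]≡n m≤depth)

  ancestor-self : ∀ v → ancestor v (depth v) ≡ v
  ancestor-self v = cong (fold v parent) (n∸n≡0 (depth v))

  ancestor-ancestor : ∀ {v l m} → l ≤ m → m ≤ depth v → ancestor (ancestor v m) l ≡ ancestor v l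
  ancestor-ancestor {v} {l} {m} l≤m m≤depth = begin
    fold (ancestor v m) parent (depth (ancestor v m) ∸ l) ≡⟨ cong (λ d → fold (ancestor v m) parent (d ∸ l)) (depth-ancestor m≤depth) ⟩
    fold (fold v parent (depth v ∸ m)) parent (m ∸ l)     ≡⟨ sym (fold-+ v parent (m ∸ l)) ⟩
    fold v parent ((m ∸ l) + (depth v ∸ m))               ≡⟨ cong (fold v parent) steps-add-up ⟩
    fold v parent (depth v ∸ l)                           ∎
    where
    open ≡-Reasoning
    steps-add-up : (m ∸ l) + (depth v ∸ m) ≡ depth v ∸ l
    steps-add-up = begin
      (m ∸ l) + (depth v ∸ m) ≡⟨ +-comm (m ∸ l) _ ⟩
      (depth v ∸ m) + (m ∸ l) ≡⟨ sym (+-∸-assoc (depth v ∸ m) l≤m) ⟩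
      (depth v ∸ m) + m ∸ l   ≡⟨ cong (_∸ l) (m∸n+n≡m m≤depth) ⟩
      depth v ∸ l             ∎

  parent-ancestor : ∀ {v m} → suc m ≤ depth v → parent (ancestor v (suc m)) ≡ ancestor v m
  parent-ancestor {v} 1+m≤depth = cong (fold v parent) (sym (+-∸-assoc 1 1+m≤depth))

  ancestor-edge : ∀ {v m} → suc m ≤ depth v → E D (ancestor v m) (ancestor v (suc m))
  ancestor-edge {v} {m} 1+m≤depth =
    subst (λ u → E D u (ancestor v (suc m))) (parent-ancestor 1+m≤depth)
      (parent-edge λ depth≡0 → 1+n≢0 (trans (sym (depth-ancestor 1+m≤depth)) depth≡0))

  _≼_ : V D → V D → Set
  x ≼ v = depth x ≤ depth v × ancestor v (depth x) ≡ x

  ≼-refl : ∀ {v} → v ≼ v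
  ≼-refl {v} = ≤-refl , ancestor-self v

  ≼-trans : ∀ {x y z} → x ≼ y → y ≼ z → x ≼ z
  ≼-trans {x} {y} {z} (dx≤dy , y↑x) (dy≤dz , z↑y) =
    ≤-trans dx≤dy dy≤dz ,
    trans (sym (ancestor-ancestor dx≤dy dy≤dz)) (trans (cong (λ u → ancestor u (depth x)) z↑y) y↑x)

  ≼-unique : ∀ {x y v} → x ≼ v → y ≼ v → depth x ≡ depth y → x ≡ y
  ≼-unique {v = v} (_ , v↑x) (_ , v↑y) dx≡dy = trans (sym v↑x) (trans (cong (ancestor v) dx≡dy) v↑y)

  ≼-between : ∀ {x y v} → x ≼ v → y ≼ v → depth x ≤ depth y → x ≼ y
  ≼-between {x} {y} (_ , v↑x) (dy≤dv , v↑y) dx≤dy =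
    dx≤dy ,
    trans (cong (λ u → ancestor u (depth x)) (sym v↑y)) (trans (ancestor-ancestor dx≤dy dy≤dv) v↑x)

  ancestor-≼ : ∀ {v m} → m ≤ depth v → ancestor v m ≼ v
  ancestor-≼ {v} m≤depth =
    subst (_≤ depth v) (sym (depth-ancestor m≤depth)) m≤depth , cong (ancestor v) (depth-ancestor m≤depth)

  root-≼ : ∀ v → root ≼ v
  root-≼ v = subst (_≼ v) (depth≡0⇒root (trans (depth-ancestor 0≤depth) depth-root)) (ancestor-≼ 0≤depth)
    where
    0≤depth : depth root ≤ depth v
    0≤depth = subst (_≤ depth v) (sym depth-root) z≤n

  parent-≼ : ∀ {v m} → depth v ≡ suc m → parent v ≼ v
  parent-≼ {v} {m} depth≡1+m =
    subst (_≼ v) (trans (sym (parent-ancestor 1+m≤depth)) (cong parent v-at-own-depth)) (ancestor-≼ (<⇒≤ 1+m≤depth))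
    where
    1+m≤depth : suc m ≤ depth v
    1+m≤depth = ≤-reflexive (sym depth≡1+m)
    v-at-own-depth : ancestor v (suc m) ≡ v
    v-at-own-depth = trans (cong (ancestor v) (sym depth≡1+m)) (ancestor-self v)

  treePath : (x v : V D) → Fin (suc (depth v ∸ depth x)) → V D
  treePath x v j = ancestor v (depth x + toℕ j)

  module _ {x v : V D} (x≼v : x ≼ v) where

    private
      treePath-bound : ∀ j → depth x + toℕ j ≤ depth v
      treePath-bound j = begin
        depth x + toℕ j             ≤⟨ +-monoʳ-≤ (depth x) (≤-pred (toℕ<n j)) ⟩
        depth x + (depth v ∸ depth x) ≡⟨ m+[n∸m]≡n (proj₁ x≼v) ⟩
        depth v                       ∎
        where open ≤-Reasoning

    treePath-depth : ∀ j → depth (treePath x v j) ≡ depth x + toℕ j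
    treePath-depth j = depth-ancestor (treePath-bound j)

    treePath-injective : Injective (treePath x v)
    treePath-injective {i} {j} same = toℕ-injective (+-cancelˡ-≡ (depth x) _ _
      (trans (sym (treePath-depth i)) (trans (cong depth same) (treePath-depth j))))

    treePath-first : treePath x v zero ≡ x
    treePath-first = trans (cong (ancestor v) (+-identityʳ (depth x))) (proj₂ x≼v)

    treePath-last : treePath x v (fromℕ (depth v ∸ depth x)) ≡ v
    treePath-last = begin
      ancestor v (depth x + toℕ (fromℕ (depth v ∸ depth x))) ≡⟨ cong (λ k → ancestor v (depth x + k)) (toℕ-fromℕ _) ⟩
      ancestor v (depth x + (depth v ∸ depth x))             ≡⟨ cong (ancestor v) (m+[n∸m]≡n (proj₁ x≼v)) ⟩
      ancestor v (depth v)                                   ≡⟨ ancestor-self v ⟩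
      v                                                      ∎
      where open ≡-Reasoning

    treePath-edge : ∀ j → E D (treePath x v (inject₁ j)) (treePath x v (suc j))
    treePath-edge j =
      subst₂ (E D) (cong (λ k → ancestor v (depth x + k)) (sym (toℕ-inject₁ j)))
                   (cong (ancestor v) (sym (+-suc (depth x) (toℕ j))))
        (ancestor-edge step-fits)
      where
      step-fits : suc (depth x + toℕ j) ≤ depth v
      step-fits = begin
        suc (depth x + toℕ j)         ≡⟨ sym (+-suc (depth x) (toℕ j)) ⟩
        depth x + suc (toℕ j)         ≤⟨ +-monoʳ-≤ (depth x) (toℕ<n j) ⟩
        depth x + (depth v ∸ depth x) ≡⟨ m+[n∸m]≡n (proj₁ x≼v) ⟩
        depth v                       ∎
        where open ≤-Reasoning

    treePath-≼ : ∀ j → treePath x v j ≼ v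
    treePath-≼ j = ancestor-≼ (treePath-bound j)

    ≼-treePath : ∀ j → x ≼ treePath x v j
    ≼-treePath j = ≼-between x≼v (treePath-≼ j) (subst (depth x ≤_) (sym (treePath-depth j)) (m≤m+n _ _))

module StarOrCombSubsequence (lem : ExcludedMiddle 0ℓ) (D : Digraph) (root : V D)
                             (reach : ∀ v → Star (E D) root v)
                             (t : ℕ → V D) (t-injective : Injective t) where
  open Classical lem
  open ShortestPathTree lem D root reach

  Rich : V D → Set
  Rich x = InfinitelyOften (λ i → x ≼ t i)

  root-rich : Rich root
  root-rich (N , none-beyond) = none-beyond N ≤-refl (root-≼ (t N))

  record RichChild (x : V D) : Set where
    field
      child        : V D
      depth-child  : depth child ≡ suc (depth x)
      parent-child : parent child ≡ x
      rich         : Rich child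

  module CombCase (rich-child : ∀ {x} → Rich x → RichChild x) where

    spine : ℕ → ∃[ x ] Rich x
    spine zero = root , root-rich
    spine (suc n) = let open RichChild (rich-child (proj₂ (spine n))) in child , rich

    x : ℕ → V D
    x n = proj₁ (spine n)

    depth-x : ∀ n → depth (x n) ≡ n
    depth-x zero = depth-root
    depth-x (suc n) = trans (RichChild.depth-child (rich-child (proj₂ (spine n)))) (cong suc (depth-x n))

    x-≼-suc : ∀ n → x n ≼ x (suc n)
    x-≼-suc n = subst (_≼ x (suc n)) (RichChild.parent-child (rich-child (proj₂ (spine n))))
                      (parent-≼ (depth-x (suc n)))

    x-≼ : ∀ {m n} → m ≤ n → x m ≼ x n
    x-≼ = stepwise {R = _≼_} ≼-refl ≼-trans x x-≼-suc

    record Branch (M : ℕ) : Set where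
      field
        target       : ℕ
        fork         : ℕ
        beyond       : M ≤ fork
        fork-≼       : x fork ≼ t target
        leaves-spine : ¬ x (suc fork) ≼ t target

    -- The fork is the spine vertex just before the first one that is not an ancestor of the target.
    branch : ∀ M → Branch M
    branch M =
      let (i , _ , xM≼ti) = unbounded (proj₂ (spine M)) 0
          (m , m-off , before-m-on) = least-witness (λ m → ¬ x m ≼ t i) (suc (depth (t i))) (spine-outgrows i)
      in last-on-spine xM≼ti m m-off before-m-on
      where
      spine-outgrows : ∀ i → ¬ x (suc (depth (t i))) ≼ t i
      spine-outgrows i (deeper , _) = 1+n≰n (subst (_≤ depth (t i)) (depth-x _) deeper)

      last-on-spine : ∀ {i} → x M ≼ t i → ∀ m → ¬ x m ≼ t i →
                      (∀ k → k < m → ¬ ¬ x k ≼ t i) → Branch M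
      last-on-spine xM≼ti zero x0-off _ = contradiction (root-≼ _) x0-off
      last-on-spine {i} xM≼ti (suc e) off before-on = record
        { target = i
        ; fork = e
        ; beyond = ≮⇒≥ λ e<M → off (≼-trans (x-≼ e<M) xM≼ti)
        ; fork-≼ = ¬¬-elim (before-on e ≤-refl)
        ; leaves-spine = off
        }

    branches : ℕ → ∃[ M ] Branch M
    branches zero = 0 , branch 0
    branches (suc k) = suc (Branch.fork (proj₂ (branches k))) , branch _

    module _ (k : ℕ) where
      open Branch (proj₂ (branches k)) public

    fork-increasing : ∀ k → fork k < fork (suc k)
    fork-increasing k = beyond (suc k)

    later-fork-not-≼ : ∀ {a b} → a < b → ¬ x (fork b) ≼ t (target a)
    later-fork-not-≼ {a} {b} a<b xb≼ta =
      leaves-spine a (≼-trans (x-≼ (increasing⇒strictly-monotone fork-increasing a<b)) xb≼ta)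

    target-injective : Injective target
    target-injective = injective-if-< λ {a} {b} a<b ta≡tb →
      later-fork-not-≼ a<b (subst (λ i → x (fork b) ≼ t i) (sym ta≡tb) (fork-≼ b))

    branchPath : (k : ℕ) → Fin (suc (depth (t (target k)) ∸ depth (x (fork k)))) → V D
    branchPath k = treePath (x (fork k)) (t (target k))

    branchPaths-disjoint : ∀ {a b} → a < b → ∀ j j' → branchPath a j ≢ branchPath b j'
    branchPaths-disjoint {a} {b} a<b j j' same =
      later-fork-not-≼ a<b (≼-trans (≼-treePath (fork-≼ b) j')
                                    (subst (_≼ t (target a)) same (treePath-≼ (fork-≼ a) j)))

    branchPath-off-spine : ∀ k j n → branchPath k (suc j) ≢ x n
    branchPath-off-spine k j n same =
      leaves-spine k (≼-trans (x-≼ past-fork) (subst (_≼ t (target k)) same (treePath-≼ (fork-≼ k) (suc j))))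
      where
      past-fork : suc (fork k) ≤ n
      past-fork = begin
        suc (fork k)                 ≤⟨ s≤s (m≤m+n (fork k) (toℕ j)) ⟩
        suc (fork k + toℕ j)         ≡⟨ sym (+-suc (fork k) (toℕ j)) ⟩
        fork k + suc (toℕ j)         ≡⟨ cong (_+ suc (toℕ j)) (sym (depth-x (fork k))) ⟩
        depth (x (fork k)) + toℕ (suc j) ≡⟨ sym (treePath-depth (fork-≼ k) (suc j)) ⟩
        depth (branchPath k (suc j)) ≡⟨ cong depth same ⟩
        depth (x n)                  ≡⟨ depth-x n ⟩
        n                            ∎
        where open ≤-Reasoning

    comb : (g : ℕ → ℕ) → Injective g → Comb D (Image (t ∘ target ∘ g))
    comb g g-injective = record
      { spine      = x
      ; spine-inj  = λ {m} {n} xm≡xn → trans (sym (depth-x m)) (trans (cong depth xm≡xn) (depth-x n))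
      ; spine-edge = λ n → subst (λ u → E D u (x (suc n))) (RichChild.parent-child (rich-child (proj₂ (spine n))))
                                 (parent-edge λ d≡0 → 1+n≢0 (trans (sym (depth-x (suc n))) d≡0))
      ; I          = ℕ
      ; I-inf      = ℕ-infinite
      ; len        = λ k → depth (t (target (g k))) ∸ depth (x (fork (g k)))
      ; leg        = branchPath ∘ g
      ; leg-inj    = λ k → treePath-injective (fork-≼ (g k))
      ; leg-edge   = λ k → treePath-edge (fork-≼ (g k))
      ; leg-first  = λ k → fork (g k) , treePath-first (fork-≼ (g k))
      ; leg-rest   = branchPath-off-spine ∘ g
      ; leg-disj   = λ k k' j j' k≢k' →
                       wlog-< {R = λ a b → ∀ j j' → branchPath a j ≢ branchPath b j'}
                              (λ disjoint j j' same → disjoint j' j (sym same))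
                              branchPaths-disjoint (k≢k' ∘ g-injective) j j'
      ; teeth      = λ v → mk⇔ (λ (k , tk≡v) → k , trans (treePath-last (fork-≼ (g k))) tk≡v)
                                (λ (k , last≡v) → k , trans (sym (treePath-last (fork-≼ (g k)))) last≡v)
      }

    conclusion : ∃[ s ] Injective s × (∀ g → Injective g → StarOrComb D (Image (t ∘ s ∘ g)))
    conclusion = target , target-injective , λ g g-injective → inj₂ (comb g g-injective)

  module StarCase {x : V D} (rich-x : Rich x) (no-rich-child : ¬ RichChild x) where

    record Leaf (B : ℕ) : Set where
      field
        target       : ℕ
        beyond       : B ≤ target
        child        : V D
        depth-child  : depth child ≡ suc (depth x)
        parent-child : parent child ≡ x
        child-≼      : child ≼ t target

    strictly-below : ∀ B → ∃[ i ] B ≤ i × x ≼ t i × t i ≢ x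
    strictly-below B with unbounded rich-x B
    ... | i , B≤i , x≼ti with lem {t i ≡ x}
    ...   | no ti≢x = i , B≤i , x≼ti , ti≢x
    ...   | yes ti≡x =
      let (i' , i<i' , x≼ti') = unbounded rich-x (suc i)
      in i' , ≤-trans B≤i (<⇒≤ i<i') , x≼ti' , λ ti'≡x → <⇒≢ i<i' (t-injective (trans ti≡x (sym ti'≡x)))

    leaf : ∀ B → Leaf B
    leaf B =
      let (i , B≤i , x≼ti , ti≢x) = strictly-below B
          dx<dti : suc (depth x) ≤ depth (t i)
          dx<dti = ≤∧≢⇒< (proj₁ x≼ti) λ same-depth → ti≢x (≼-unique ≼-refl x≼ti (sym same-depth))
      in record
        { target = i
        ; beyond = B≤i
        ; child = ancestor (t i) (suc (depth x))
        ; depth-child = depth-ancestor dx<dti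
        ; parent-child = trans (parent-ancestor dx<dti) (proj₂ x≼ti)
        ; child-≼ = ancestor-≼ dx<dti
        }

    finitely-often-below-child : ∀ {B} (l : Leaf B) → FinitelyOften (λ i → Leaf.child l ≼ t i)
    finitely-often-below-child l = ¬¬-elim λ rich → no-rich-child record
      { child = Leaf.child l ; depth-child = Leaf.depth-child l ; parent-child = Leaf.parent-child l ; rich = rich }

    -- Each chosen child is above no target beyond the next bound, so later targets avoid its subtree.
    bound : ℕ → ℕ
    bound zero = 0
    bound (suc k) = suc (bound k + proj₁ (finitely-often-below-child (leaf (bound k))))

    module _ (k : ℕ) where
      open Leaf (leaf (bound k)) public

    bound-increasing : ∀ k → bound k < bound (suc k)
    bound-increasing k = s≤s (m≤m+n (bound k) _)

    child-not-≼-later : ∀ {a b} → a < b → ¬ child a ≼ t (target b)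
    child-not-≼-later {a} {b} a<b = proj₂ (finitely-often-below-child (leaf (bound a))) (target b) cutoff≤target
      where
      cutoff≤target : proj₁ (finitely-often-below-child (leaf (bound a))) ≤ target b
      cutoff≤target = ≤-trans (m≤n⇒m≤1+n (m≤n+m _ (bound a)))
                        (≤-trans (increasing⇒monotone bound-increasing a<b) (beyond b))

    target-injective : Injective target
    target-injective = injective-if-< λ {a} {b} a<b ta≡tb →
      child-not-≼-later a<b (subst (λ i → child a ≼ t i) ta≡tb (child-≼ a))

    child-injective : Injective child
    child-injective = injective-if-< λ {a} {b} a<b ca≡cb →
      child-not-≼-later a<b (subst (_≼ t (target b)) (sym ca≡cb) (child-≼ b))

    childPath-avoids-x : ∀ k j → treePath (child k) (t (target k)) j ≢ x
    childPath-avoids-x k j same = 1+n≰n (begin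
      suc (depth x)                                        ≡⟨ sym (depth-child k) ⟩
      depth (child k)                                      ≤⟨ m≤m+n _ (toℕ j) ⟩
      depth (child k) + toℕ j                              ≡⟨ sym (treePath-depth (child-≼ k) j) ⟩
      depth (treePath (child k) (t (target k)) j)          ≡⟨ cong depth same ⟩
      depth x                                              ∎)
      where open ≤-Reasoning

    star : (g : ℕ → ℕ) → Injective g → Star* D (Image (t ∘ target ∘ g))
    star g g-injective = record
      { centre   = x
      ; I        = ℕ
      ; I-inf    = ℕ-infinite
      ; len      = λ k → depth (t (target (g k))) ∸ depth (child (g k))
      ; leg      = leg
      ; leg-inj  = λ k → ∷-injective (childPath-avoids-x (g k)) (treePath-injective (child-≼ (g k)))
      ; leg-edge = leg-edge
      ; leg-root = λ k → refl
      ; leg-disj = leg-disj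
      ; leaves   = λ v → mk⇔ (λ (k , tk≡v) → k , trans (treePath-last (child-≼ (g k))) tk≡v)
                              (λ (k , last≡v) → k , trans (sym (treePath-last (child-≼ (g k)))) last≡v)
      }
      where
      leg : (k : ℕ) → Fin (suc (suc (depth (t (target (g k))) ∸ depth (child (g k))))) → V D
      leg k = x Vector.∷ treePath (child (g k)) (t (target (g k)))

      leg-edge : ∀ k j → E D (leg k (inject₁ j)) (leg k (suc j))
      leg-edge k zero = subst₂ (E D) (parent-child (g k)) (sym (treePath-first (child-≼ (g k))))
                          (parent-edge λ d≡0 → 1+n≢0 (trans (sym (depth-child (g k))) d≡0))
      leg-edge k (suc j) = treePath-edge (child-≼ (g k)) j

      leg-disj : ∀ k k' j j' → k ≢ k' → leg k j ≡ leg k' j' → (j ≡ zero) × (j' ≡ zero)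
      leg-disj k k' zero zero _ _ = refl , refl
      leg-disj k k' zero (suc j') _ same = contradiction (sym same) (childPath-avoids-x (g k') j')
      leg-disj k k' (suc j) zero _ same = contradiction same (childPath-avoids-x (g k) j)
      leg-disj k k' (suc j) (suc j') k≢k' same = contradiction (g-injective (child-injective same-child)) k≢k'
        where
        same-child : child (g k) ≡ child (g k')
        same-child = ≼-unique (≼-treePath (child-≼ (g k)) j)
                              (subst (child (g k') ≼_) (sym same) (≼-treePath (child-≼ (g k')) j'))
                              (trans (depth-child (g k)) (sym (depth-child (g k'))))

    conclusion : ∃[ s ] Injective s × (∀ g → Injective g → StarOrComb D (Image (t ∘ s ∘ g)))
    conclusion = target , target-injective , λ g g-injective → inj₁ (star g g-injective)

  conclusion : ∃[ s ] Injective s × (∀ g → Injective g → StarOrComb D (Image (t ∘ s ∘ g)))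
  conclusion with lem {∃[ x ] Rich x × ¬ RichChild x}
  ... | yes (_ , rich-x , no-rich-child) = StarCase.conclusion rich-x no-rich-child
  ... | no every-rich-has-rich-child =
    CombCase.conclusion λ {x} rich-x → ¬¬-elim λ no-rich-child → every-rich-has-rich-child (x , rich-x , no-rich-child)

reverse-stronglyConnected : ∀ D → StronglyConnected D → StronglyConnected (reverse D)
reverse-stronglyConnected D strong u v = Star.reverse id (strong v u)

starOrComb-subsequence : ExcludedMiddle 0ℓ → (D : Digraph) → StronglyConnected D →
                         (t : ℕ → V D) → Injective t →
                         ∃[ s ] Injective s × (∀ g → Injective g → StarOrComb D (Image (t ∘ s ∘ g)))
starOrComb-subsequence lem D strong t t-injective =
  StarOrCombSubsequence.conclusion lem D (t 0) (strong (t 0)) t t-injective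

lemma3p2 : ExcludedMiddle 0ℓ →
    (D : Digraph) → StronglyConnected D →
    (U : V D → Set) → InfiniteSubset U →
    ∃[ L ] ((L ⊆ U) × (Star* D L ⊎ Comb D L) × (ReverseStar D L ⊎ ReverseComb D L))
lemma3p2 lem D strong U infinite =
  let (t , t-injective , t∈U) = Classical.injective-enumeration lem {U = U} infinite
      (s₁ , s₁-injective , forward) = starOrComb-subsequence lem D strong t t-injective
      (s₂ , s₂-injective , backward) =
        starOrComb-subsequence lem (reverse D) (reverse-stronglyConnected D strong)
                               (t ∘ s₁) (λ same → s₁-injective (t-injective same))
  in Image (t ∘ s₁ ∘ s₂) ,
     (λ { _ (k , refl) → t∈U (s₁ (s₂ k)) }) ,
     forward s₂ s₂-injective ,
     backward id id
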